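{- Let $s\ge1$, $t\ge 2$, $G\in\mathcal{G}_{s,t}$ with root $r$, and let $C$ be a boundary configuration on $G$ with $k$ pebble-free vertices in $S$ and distinguished even vertex $x\in T$. If $C(x)=2$ and every pebbled vertex $v\in S$ has at least one pebble-free neighbor $u\in S$, then Defender has a winning strategy.
   Context: A configuration $C$ on a graph $G$ is a function $C:V(G)\to\mathbb{Z}_{\ge 0}$. A pebbling move removes two pebbles from a vertex and places one pebble on an adjacent vertex. The Two-Player Pebbling Game on $G$ with root $r$ and starting configuration $C$ is played by Mover and Defender in rounds: in each round Mover makes a pebbling move and then Defender makes a pebbling move; each player must take their turn. If Mover pebbles from $u$ to $v$, Defender may not pebble from $v$ to $u$ in the same round. Mover wins if at any time the root has at least one pebble; Defender wins if the root has no pebble and there are no more pebbling moves. A winning strategy is a rule choosing a player's moves as a function of the current position which guarantees that player wins. For integers $s,t\ge1$, $\mathcal{G}_{s,t}$ is the class of all graphs $(K_1\cup \overline{K_t})\vee H$, where $H$ is any graph on $s$ vertices, $\overline{K_t}$ is the edgeless graph on $t$ vertices, $\cup$ is disjoint union and $\vee$ is the join. The root $r$ is the vertex of $K_1$; $S=V(H)$, $T=V(\overline{K_t})$. A configuration is non-trivial if each vertex of $S$ has 0 or 1 pebbles and the root has no pebbles. A vertex is pebble-free if it has no pebbles, pebbled otherwise; it is even or odd according to the parity of $C(v)$. $k$ is the number of pebble-free vertices of $S$, and $C_T=\sum_{v\in T}\lfloor C(v)/2\rfloor$. For $t\ge2$, a boundary configuration is a non-trivial configuration with $k$ even and $C_T=k+2$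 such that there is one even vertex $x\in T$ with $C(x)\ge 2$ and all other vertices of $T$ have an odd number of pebbles. -}

module Defs where

open import Data.Nat using (ℕ; zero; suc; _+_; _∸_; _≤_; _≡ᵇ_)
open import Data.Nat.DivMod using (_/_)
open import Data.Nat.Divisibility using (_∣_)
open import Data.Fin using (Fin)
import Data.Fin as F
open import Data.Vec using (tabulate; sum)
open import Data.Bool using (Bool; true; false; T; if_then_else_)
open import Data.Unit using (⊤)
open import Data.Empty using (⊥)
open import Data.Product using (_×_; Σ; ∃)
open import Relation.Nullary using (¬_; Dec; yes; no)
open import Relation.Binary.PropositionalEquality using (_≡_; refl; cong)

record SimpleGraph (s : ℕ) : Set where
  field
    E     : Fin s → Fin s → Bool
    sym   : ∀ i j → E i j ≡ E j i
    irrefl : ∀ i → E i i ≡ false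
open SimpleGraph public

-- Vertices of G = (K₁ ∪ \bar{K_t}) ∨ H : the root r, S = V(H), T.
data Vtx (s t : ℕ) : Set where
  root : Vtx s t
  sv   : Fin s → Vtx s t
  tv   : Fin t → Vtx s t

Adj : ∀ {s t} → SimpleGraph s → Vtx s t → Vtx s t → Set
Adj H root   (sv _) = ⊤
Adj H (sv _) root   = ⊤
Adj H (sv i) (sv j) = T (E H i j)
Adj H (sv _) (tv _) = ⊤
Adj H (tv _) (sv _) = ⊤
Adj H _      _      = ⊥

_≟V_ : ∀ {s t} → (u v : Vtx s t) → Dec (u ≡ v)
root ≟V root = yes refl
root ≟V sv _ = no λ ()
root ≟V tv _ = no λ ()
sv _ ≟V root = no λ ()
sv i ≟V sv j with i F.≟ j
... | yes refl = yes refl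
... | no ¬p = no λ { refl → ¬p refl }
sv _ ≟V tv _ = no λ ()
tv _ ≟V root = no λ ()
tv _ ≟V sv _ = no λ ()
tv i ≟V tv j with i F.≟ j
... | yes refl = yes refl
... | no ¬p = no λ { refl → ¬p refl }

Config : ℕ → ℕ → Set
Config s t = Vtx s t → ℕ

pebble : ∀ {s t} → Config s t → Vtx s t → Vtx s t → Config s t
pebble C u v w with w ≟V u | w ≟V v
... | yes _ | _     = C w ∸ 2
... | no _  | yes _ = C w + 1
... | no _  | no _  = C w

Move : ∀ {s t} → SimpleGraph s → Config s t → Vtx s t → Vtx s t → Set
Move H C u v = Adj H u v × 2 ≤ C u

-- Positions of the two-player game won by Defender (game is finite since
-- every move decreases the number of pebbles, so an inductive definition
-- captures "Defender has a winning strategy").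
mutual
  data DefWinsM {s t} (H : SimpleGraph s) (C : Config s t) : Set where
    mover-turn :
      C root ≡ 0 →
      (∀ u v → Move H C u v →
         (pebble C u v root ≡ 0) × DefWinsD H (pebble C u v) u v) →
      DefWinsM H C

  -- Defender is to move at C, Mover's last move was u → v (so v → u is forbidden).
  data DefWinsD {s t} (H : SimpleGraph s) (C : Config s t) (u v : Vtx s t) : Set where
    defender-stuck :
      (∀ a b → Move H C a b → (a ≡ v × b ≡ u)) →
      DefWinsD H C u v
    defender-move : ∀ a b →
      Move H C a b → ¬ (a ≡ v × b ≡ u) →
      pebble C a b root ≡ 0 →
      DefWinsM H (pebble C a b) →
      DefWinsD H C u v

DefenderWins : ∀ {s t} → SimpleGraph s → Config s t → Set
DefenderWins H C = DefWinsM H C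

NonTrivial : ∀ {s t} → Config s t → Set
NonTrivial C = (C root ≡ 0) × (∀ i → C (sv i) ≤ 1)

kFree : ∀ {s t} → Config s t → ℕ
kFree {s} C = sum (tabulate {n = s} λ i → if C (sv i) ≡ᵇ 0 then 1 else 0)

CT : ∀ {s t} → Config s t → ℕ
CT {t = t} C = sum (tabulate {n = t} λ j → C (tv j) / 2)

Even : ℕ → Set
Even n = 2 ∣ n

Odd : ℕ → Set
Odd n = ¬ (2 ∣ n)

Boundary : ∀ {s t} → Config s t → Fin t → Set
Boundary C x =
  NonTrivial C × Even (kFree C) × (CT C ≡ kFree C + 2) ×
  Even (C (tv x)) × (2 ≤ C (tv x)) ×
  (∀ j → ¬ (j ≡ x) → Odd (C (tv j)))

module Submission where

-- Mover can only move from T to S.  Defender keeps the root empty, at most one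
-- pebble on each S-vertex, and one of four safe shapes relating the number C_T
-- of threats in T to the number k of free S-vertices: C_T ≤ k; k even and
-- C_T ≤ k + 1; k even, C_T ≤ k + 2 and every movable T-pile has an even partner
-- pile; or k even, C_T ≤ k + 2, a T-pile of exactly two pebbles and free
-- S-neighbours (the theorem's hypotheses).  If Mover fills a free vertex,
-- Defender fills another; if he doubles a pebble, Defender returns the pair to
-- T or, in the last shape, shifts it to a free neighbour.  Every round removes
-- pebbles from T, so the game ends in Defender's favour.

open import Defs hiding (sym)
open import Data.Nat using (ℕ; zero; suc; _+_; _*_; _∸_; _≤_; _<_; _≡ᵇ_; z≤n; s≤s; _≤?_; >-nonZero)
open import Data.Nat.Properties
open import Data.Nat.DivMod using (_/_; /-monoˡ-≤; m/n≡1+[m∸n]/n; m*n/n≡m; m≥n⇒m/n>0)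
open import Data.Nat.Divisibility using (divides; ∣-refl; _∣0; ∣m+n∣m⇒∣n; ∣⇒≤)
open import Data.Nat.Tactic.RingSolver using (solve-∀)
open import Data.Fin using (Fin)
import Data.Fin as F
import Data.Fin.Properties as FinP
open import Data.Vec using (tabulate; sum)
open import Data.Vec.Properties using (tabulate-cong)
open import Data.Vec.Functional using (updateAt)
open import Data.Vec.Functional.Properties using (updateAt-updates; updateAt-minimal)
open import Data.Bool using (T; if_then_else_)
open import Data.Empty using (⊥-elim)
open import Data.Product using (_×_; Σ; ∃; _,_)
open import Function using (_∘_; const)
open import Relation.Nullary using (¬_; Dec; yes; no)
open import Relation.Binary.PropositionalEquality

cancel-offset : ∀ n a b h → a + (n + h) ≡ b + h → n + a ≡ b
cancel-offset n a b h eq = +-cancelʳ-≡ h (n + a) b (trans (reassoc n a h) eq)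
  where
  reassoc : ∀ n a h → n + a + h ≡ a + (n + h)
  reassoc = solve-∀

cancel-≤ : ∀ a b h h′ → a + h ≡ b + h′ → h′ ≤ suc h → a ≤ suc b
cancel-≤ a b h h′ eq h′≤ = +-cancelʳ-≤ h a (suc b) (begin
  a + h      ≡⟨ eq ⟩
  b + h′     ≤⟨ +-monoʳ-≤ b h′≤ ⟩
  b + suc h  ≡⟨ +-suc b h ⟩
  suc b + h  ∎)
  where open ≤-Reasoning

budget-down : ∀ m {a a′ b b′} → a ≡ 2 + a′ → b ≡ 2 + b′ → a ≤ m + b → a′ ≤ m + b′
budget-down m {a′ = a′} {b′ = b′} refl refl a≤ =
  +-cancelˡ-≤ 2 a′ (m + b′) (≤-trans a≤ (≤-reflexive (pull-two m b′)))
  where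
  pull-two : ∀ m b → m + (2 + b) ≡ 2 + (m + b)
  pull-two = solve-∀

half-suc-suc : ∀ c → suc (suc c) / 2 ≡ suc (c / 2)
half-suc-suc c = m/n≡1+[m∸n]/n {suc (suc c)} {2} (s≤s (s≤s z≤n))

half-suc-≤ : ∀ c → suc c / 2 ≤ suc (c / 2)
half-suc-≤ c = ≤-trans (/-monoˡ-≤ 2 (n≤1+n (suc c))) (≤-reflexive (half-suc-suc c))

half-odd : ∀ q → suc (q * 2) / 2 ≡ q
half-odd zero = refl
half-odd (suc q) = trans (half-suc-suc (suc (q * 2))) (cong suc (half-odd q))

half-suc-even : ∀ {c} → Even c → suc c / 2 ≡ c / 2
half-suc-even (divides q refl) = trans (half-odd q) (sym (m*n/n≡m q 2))

even-∸2 : ∀ c → Even c → Even (c ∸ 2)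
even-∸2 zero e = e
even-∸2 (suc zero) _ = 2 ∣0
even-∸2 (suc (suc c)) e = ∣m+n∣m⇒∣n e ∣-refl

even-down : ∀ {b b′} → b ≡ 2 + b′ → Even b → Even b′
even-down refl e = ∣m+n∣m⇒∣n e ∣-refl

even-≥2 : ∀ {k} → Even k → 1 ≤ k → 2 ≤ k
even-≥2 e 1≤k = ∣⇒≤ {{>-nonZero 1≤k}} e

sum-update : ∀ {n} (f g : Fin n → ℕ) (i : Fin n) → (∀ j → j ≢ i → f j ≡ g j) →
  sum (tabulate f) + g i ≡ sum (tabulate g) + f i
sum-update {suc n} f g F.zero agree = begin
  f F.zero + Σf + g F.zero  ≡⟨ cong (λ σ → f F.zero + σ + g F.zero) tails ⟩
  f F.zero + Σg + g F.zero  ≡⟨ swap (f F.zero) Σg (g F.zero) ⟩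
  g F.zero + Σg + f F.zero  ∎
  where
  open ≡-Reasoning
  Σf Σg : ℕ
  Σf = sum (tabulate (f ∘ F.suc))
  Σg = sum (tabulate (g ∘ F.suc))
  tails : Σf ≡ Σg
  tails = cong sum (tabulate-cong (λ j → agree (F.suc j) λ ()))
  swap : ∀ a b c → a + b + c ≡ c + b + a
  swap = solve-∀
sum-update {suc n} f g (F.suc i) agree = begin
  f F.zero + Σf + g (F.suc i)    ≡⟨ +-assoc (f F.zero) Σf _ ⟩
  f F.zero + (Σf + g (F.suc i))  ≡⟨ cong₂ _+_ (agree F.zero λ ()) tails ⟩
  g F.zero + (Σg + f (F.suc i))  ≡⟨ +-assoc (g F.zero) Σg _ ⟨
  g F.zero + Σg + f (F.suc i)    ∎
  where
  open ≡-Reasoning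
  Σf Σg : ℕ
  Σf = sum (tabulate (f ∘ F.suc))
  Σg = sum (tabulate (g ∘ F.suc))
  tails : Σf + g (F.suc i) ≡ Σg + f (F.suc i)
  tails = sum-update (f ∘ F.suc) (g ∘ F.suc) i
            (λ j j≢i → agree (F.suc j) (j≢i ∘ FinP.suc-injective))

sum-update₂ : ∀ {n} (f g : Fin n → ℕ) (i u : Fin n) → i ≢ u →
  (∀ j → j ≢ i → j ≢ u → f j ≡ g j) →
  sum (tabulate f) + (g i + g u) ≡ sum (tabulate g) + (f i + f u)
sum-update₂ f g i u i≢u agree = begin
  total f + (g i + g u)    ≡⟨ cong (total f +_) (+-comm (g i) (g u)) ⟩
  total f + (g u + g i)    ≡⟨ +-assoc (total f) (g u) (g i) ⟨
  total f + g u + g i      ≡⟨ cong (_+ g i) f→h ⟩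
  total h + f u + g i      ≡⟨ +-assoc (total h) (f u) (g i) ⟩
  total h + (f u + g i)    ≡⟨ cong (total h +_) (+-comm (f u) (g i)) ⟩
  total h + (g i + f u)    ≡⟨ +-assoc (total h) (g i) (f u) ⟨
  total h + g i + f u      ≡⟨ cong (_+ f u) h→g ⟩
  total g + f i + f u      ≡⟨ +-assoc (total g) (f i) (f u) ⟩
  total g + (f i + f u)    ∎
  where
  open ≡-Reasoning
  total : (Fin _ → ℕ) → ℕ
  total φ = sum (tabulate φ)
  h : Fin _ → ℕ
  h = updateAt f u (const (g u))
  f→h : total f + g u ≡ total h + f u
  f→h = trans (cong (total f +_) (sym (updateAt-updates u f)))
              (sum-update f h u (λ j j≢u → sym (updateAt-minimal j u f j≢u)))
  h-agrees : ∀ j → j ≢ i → h j ≡ g j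
  h-agrees j j≢i with j FinP.≟ u
  ... | yes refl = updateAt-updates u f
  ... | no j≢u = trans (updateAt-minimal j u f j≢u) (agree j j≢i j≢u)
  h→g : total h + g i ≡ total g + f i
  h→g = trans (sum-update h g i h-agrees)
              (cong (total g +_) (updateAt-minimal i u f i≢u))

term≤sum : ∀ {n} (f : Fin n → ℕ) j → f j ≤ sum (tabulate f)
term≤sum f F.zero = m≤m+n (f F.zero) _
term≤sum f (F.suc j) = ≤-trans (term≤sum (f ∘ F.suc) j) (m≤n+m _ (f F.zero))

positive-term : ∀ {n} (f : Fin n → ℕ) → 1 ≤ sum (tabulate f) → ∃ λ j → 1 ≤ f j
positive-term {suc n} f pos with f F.zero in eq
... | suc _ = F.zero , subst (1 ≤_) (sym eq) (s≤s z≤n)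
... | zero with positive-term (f ∘ F.suc) pos
...   | j , 1≤fj = F.suc j , 1≤fj

at-and-off : ∀ {n} (P : Fin n → Set) i → P i → (∀ i′ → i′ ≢ i → P i′) → ∀ i′ → P i′
at-and-off P i at off i′ with i′ FinP.≟ i
... | yes refl = at
... | no i′≢i = off i′ i′≢i

another : ∀ {t} → 2 ≤ t → (j : Fin t) → ∃ λ j′ → j′ ≢ j
another {suc zero} (s≤s ()) _
another {suc (suc _)} _ F.zero = F.suc F.zero , λ ()
another {suc (suc _)} _ (F.suc _) = F.zero , λ ()

pebble-source : ∀ {s t} (C : Config s t) u v → pebble C u v u ≡ C u ∸ 2
pebble-source C u v with u ≟V u
... | yes _ = refl
... | no u≢u = ⊥-elim (u≢u refl)

pebble-target : ∀ {s t} (C : Config s t) u v → v ≢ u → pebble C u v v ≡ suc (C v)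
pebble-target C u v v≢u with v ≟V u | v ≟V v
... | yes v≡u | _ = ⊥-elim (v≢u v≡u)
... | no _ | yes _ = +-comm (C v) 1
... | no _ | no v≢v = ⊥-elim (v≢v refl)

pebble-other : ∀ {s t} (C : Config s t) u v w → w ≢ u → w ≢ v → pebble C u v w ≡ C w
pebble-other C u v w w≢u w≢v with w ≟V u | w ≟V v
... | yes w≡u | _ = ⊥-elim (w≢u w≡u)
... | no _ | yes w≡v = ⊥-elim (w≢v w≡v)
... | no _ | no _ = refl

free : ℕ → ℕ
free c = if c ≡ᵇ 0 then 1 else 0

free-positive : ∀ c → 1 ≤ free c → c ≡ 0
free-positive zero _ = refl

cannot-move : ∀ {c} → c ≤ 1 → ¬ 2 ≤ c
cannot-move = ≤⇒≯

module _ {s t : ℕ} where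

  ΣS : (ℕ → ℕ) → Config s t → ℕ
  ΣS φ C = sum (tabulate λ i → φ (C (sv i)))

  ΣT : (ℕ → ℕ) → Config s t → ℕ
  ΣT φ C = sum (tabulate λ j → φ (C (tv j)))

  -- The number of pebbles on T; it drops in every round and bounds the game.
  tPebbles : Config s t → ℕ
  tPebbles = ΣT (λ c → c)

  ΣS-update : ∀ φ (C C′ : Config s t) i → (∀ i′ → i′ ≢ i → C′ (sv i′) ≡ C (sv i′)) →
    ΣS φ C′ + φ (C (sv i)) ≡ ΣS φ C + φ (C′ (sv i))
  ΣS-update φ C C′ i agree = sum-update _ _ i (λ i′ i′≢i → cong φ (agree i′ i′≢i))

  ΣS-update₂ : ∀ φ (C C′ : Config s t) i u → i ≢ u →
    (∀ i′ → i′ ≢ i → i′ ≢ u → C′ (sv i′) ≡ C (sv i′)) →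
    ΣS φ C′ + (φ (C (sv i)) + φ (C (sv u))) ≡ ΣS φ C + (φ (C′ (sv i)) + φ (C′ (sv u)))
  ΣS-update₂ φ C C′ i u i≢u agree =
    sum-update₂ _ _ i u i≢u (λ i′ i′≢i i′≢u → cong φ (agree i′ i′≢i i′≢u))

  ΣT-update : ∀ φ (C C′ : Config s t) j → (∀ j′ → j′ ≢ j → C′ (tv j′) ≡ C (tv j′)) →
    ΣT φ C′ + φ (C (tv j)) ≡ ΣT φ C + φ (C′ (tv j))
  ΣT-update φ C C′ j agree = sum-update _ _ j (λ j′ j′≢j → cong φ (agree j′ j′≢j))

  ΣT-cong : ∀ φ (C C′ : Config s t) → (∀ j → C′ (tv j) ≡ C (tv j)) → ΣT φ C′ ≡ ΣT φ C
  ΣT-cong φ C C′ agree = cong sum (tabulate-cong (cong φ ∘ agree))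

  threat-positive : ∀ (C : Config s t) j → 2 ≤ C (tv j) → 1 ≤ CT C
  threat-positive C j 2≤ = ≤-trans (m≥n⇒m/n>0 2≤) (term≤sum (λ j′ → C (tv j′) / 2) j)

  free-vertex : ∀ (C : Config s t) → 1 ≤ kFree C → ∃ λ i → C (sv i) ≡ 0
  free-vertex C 1≤k with positive-term (λ i → free (C (sv i))) 1≤k
  ... | i , 1≤free = i , free-positive (C (sv i)) 1≤free

  SBounded : Config s t → Set
  SBounded C = ∀ i → C (sv i) ≤ 1

  -- Every T-pile that can move has an even pile elsewhere in T to receive
  -- a returned pebble without creating a threat.
  EvenPartner : Config s t → Set
  EvenPartner C = ∀ j → 2 ≤ C (tv j) → ∃ λ j′ → j′ ≢ j × Even (C (tv j′))

  empty-partner : ∀ (C : Config s t) x → C (tv x) ≡ 0 → EvenPartner C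
  empty-partner C x empty j 2≤ = x , x≢j , subst Even (sym empty) (2 ∣0)
    where
    x≢j : x ≢ j
    x≢j refl = cannot-move (≤-trans (≤-reflexive empty) z≤n) 2≤

  record Lowered (C C₂ : Config s t) : Set where
    field
      free-drop : kFree C ≡ 2 + kFree C₂
      threat-drop : CT C ≡ 2 + CT C₂

  lowered-budget : ∀ {C C₂} → Lowered C C₂ → ∀ m → CT C ≤ m + kFree C → CT C₂ ≤ m + kFree C₂
  lowered-budget low m = budget-down m threat-drop free-drop
    where open Lowered low

  lowered-even : ∀ {C C₂} → Lowered C C₂ → Even (kFree C) → Even (kFree C₂)
  lowered-even low = even-down (Lowered.free-drop low)

  module TtoS (C : Config s t) (j : Fin t) (i : Fin s) where
    C′ : Config s t
    C′ = pebble C (tv j) (sv i)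

    root-kept : C′ root ≡ C root
    root-kept = pebble-other C (tv j) (sv i) root (λ ()) (λ ())

    s-target : C′ (sv i) ≡ suc (C (sv i))
    s-target = pebble-target C (tv j) (sv i) (λ ())

    s-kept : ∀ i′ → i′ ≢ i → C′ (sv i′) ≡ C (sv i′)
    s-kept i′ i′≢i = pebble-other C (tv j) (sv i) (sv i′) (λ ()) (λ { refl → i′≢i refl })

    t-source : C′ (tv j) ≡ C (tv j) ∸ 2
    t-source = pebble-source C (tv j) (sv i)

    t-kept : ∀ j′ → j′ ≢ j → C′ (tv j′) ≡ C (tv j′)
    t-kept j′ j′≢j = pebble-other C (tv j) (sv i) (tv j′) (λ { refl → j′≢j refl }) (λ ())

    free-count : kFree C′ + free (C (sv i)) ≡ kFree C + free (suc (C (sv i)))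
    free-count = trans (ΣS-update free C C′ i s-kept) (cong (λ c → kFree C + free c) s-target)

    filled : C (sv i) ≡ 0 → suc (kFree C′) ≡ kFree C
    filled empty = cancel-offset 1 (kFree C′) (kFree C) 0
      (subst (λ c → kFree C′ + free c ≡ kFree C + free (suc c)) empty free-count)

    doubled : C (sv i) ≡ 1 → kFree C′ ≡ kFree C
    doubled one = +-cancelʳ-≡ 0 (kFree C′) (kFree C)
      (subst (λ c → kFree C′ + free c ≡ kFree C + free (suc c)) one free-count)

    threats-drop : 2 ≤ C (tv j) → suc (CT C′) ≡ CT C
    threats-drop 2≤ = cancel-offset 1 (CT C′) (CT C) rest (begin
      CT C′ + suc rest      ≡⟨ cong (CT C′ +_) (m/n≡1+[m∸n]/n 2≤) ⟨
      CT C′ + C (tv j) / 2  ≡⟨ ΣT-update (_/ 2) C C′ j t-kept ⟩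
      CT C + C′ (tv j) / 2  ≡⟨ cong (λ c → CT C + c / 2) t-source ⟩
      CT C + rest           ∎)
      where
      open ≡-Reasoning
      rest : ℕ
      rest = (C (tv j) ∸ 2) / 2

    t-pebbles-drop : 2 ≤ C (tv j) → 2 + tPebbles C′ ≡ tPebbles C
    t-pebbles-drop 2≤ = cancel-offset 2 (tPebbles C′) (tPebbles C) (C (tv j) ∸ 2) (begin
      tPebbles C′ + (2 + (C (tv j) ∸ 2))  ≡⟨ cong (tPebbles C′ +_) (m+[n∸m]≡n 2≤) ⟩
      tPebbles C′ + C (tv j)             ≡⟨ ΣT-update (λ c → c) C C′ j t-kept ⟩
      tPebbles C + C′ (tv j)             ≡⟨ cong (tPebbles C +_) t-source ⟩
      tPebbles C + (C (tv j) ∸ 2)        ∎)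
      where open ≡-Reasoning

    fill-bounded : SBounded C → C (sv i) ≡ 0 → SBounded C′
    fill-bounded bounded empty = at-and-off (λ i′ → C′ (sv i′) ≤ 1) i
      (≤-reflexive (trans s-target (cong suc empty)))
      (λ i′ i′≢i → subst (_≤ 1) (sym (s-kept i′ i′≢i)) (bounded i′))

    -- T-piles only shrink, by an even amount, so even partners survive.
    t-shrinks : ∀ j′ → C′ (tv j′) ≤ C (tv j′)
    t-shrinks = at-and-off (λ j′ → C′ (tv j′) ≤ C (tv j′)) j
      (subst (_≤ C (tv j)) (sym t-source) (m∸n≤m (C (tv j)) 2))
      (λ j′ j′≢j → ≤-reflexive (t-kept j′ j′≢j))

    t-stays-even : ∀ j′ → Even (C (tv j′)) → Even (C′ (tv j′))
    t-stays-even = at-and-off (λ j′ → Even (C (tv j′)) → Even (C′ (tv j′))) j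
      (λ even → subst Even (sym t-source) (even-∸2 (C (tv j)) even))
      (λ j′ j′≢j → subst Even (sym (t-kept j′ j′≢j)))

    partner-kept : EvenPartner C → EvenPartner C′
    partner-kept partner j₀ 2≤₀ with partner j₀ (≤-trans 2≤₀ (t-shrinks j₀))
    ... | j′ , j′≢j₀ , even = j′ , j′≢j₀ , t-stays-even j′ even

  module StoT (C : Config s t) (i : Fin s) (j : Fin t) where
    C′ : Config s t
    C′ = pebble C (sv i) (tv j)

    root-kept : C′ root ≡ C root
    root-kept = pebble-other C (sv i) (tv j) root (λ ()) (λ ())

    s-source : C′ (sv i) ≡ C (sv i) ∸ 2
    s-source = pebble-source C (sv i) (tv j)

    s-kept : ∀ i′ → i′ ≢ i → C′ (sv i′) ≡ C (sv i′)
    s-kept i′ i′≢i = pebble-other C (sv i) (tv j) (sv i′) (λ { refl → i′≢i refl }) (λ ())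

    t-target : C′ (tv j) ≡ suc (C (tv j))
    t-target = pebble-target C (sv i) (tv j) (λ ())

    t-kept : ∀ j′ → j′ ≢ j → C′ (tv j′) ≡ C (tv j′)
    t-kept j′ j′≢j = pebble-other C (sv i) (tv j) (tv j′) (λ ()) (λ { refl → j′≢j refl })

    emptied : C (sv i) ≡ 2 → kFree C′ ≡ suc (kFree C)
    emptied two = sym (cancel-offset 1 (kFree C) (kFree C′) 0 (sym (begin
      kFree C′ + 0                 ≡⟨ cong (λ c → kFree C′ + free c) (sym two) ⟩
      kFree C′ + free (C (sv i))   ≡⟨ ΣS-update free C C′ i s-kept ⟩
      kFree C + free (C′ (sv i))   ≡⟨ cong (λ c → kFree C + free c) (trans s-source (cong (_∸ 2) two)) ⟩
      kFree C + 1                  ∎)))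
      where open ≡-Reasoning

    threats-count : CT C′ + C (tv j) / 2 ≡ CT C + suc (C (tv j)) / 2
    threats-count = trans (ΣT-update (_/ 2) C C′ j t-kept) (cong (λ c → CT C + c / 2) t-target)

    threats-rise : CT C′ ≤ suc (CT C)
    threats-rise = cancel-≤ (CT C′) (CT C) _ _ threats-count (half-suc-≤ (C (tv j)))

    threats-kept : Even (C (tv j)) → CT C′ ≡ CT C
    threats-kept even = +-cancelʳ-≡ (C (tv j) / 2) (CT C′) (CT C)
      (trans threats-count (cong (CT C +_) (half-suc-even even)))

    t-pebbles-rise : tPebbles C′ ≡ suc (tPebbles C)
    t-pebbles-rise = sym (cancel-offset 1 (tPebbles C) (tPebbles C′) (C (tv j))
      (sym (trans (ΣT-update (λ c → c) C C′ j t-kept) (cong (tPebbles C +_) t-target))))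

  module StoS (C : Config s t) (i u : Fin s) (i≢u : i ≢ u) where
    C′ : Config s t
    C′ = pebble C (sv i) (sv u)

    root-kept : C′ root ≡ C root
    root-kept = pebble-other C (sv i) (sv u) root (λ ()) (λ ())

    s-source : C′ (sv i) ≡ C (sv i) ∸ 2
    s-source = pebble-source C (sv i) (sv u)

    s-target : C′ (sv u) ≡ suc (C (sv u))
    s-target = pebble-target C (sv i) (sv u) (λ { refl → i≢u refl })

    s-kept : ∀ i′ → i′ ≢ i → i′ ≢ u → C′ (sv i′) ≡ C (sv i′)
    s-kept i′ i′≢i i′≢u =
      pebble-other C (sv i) (sv u) (sv i′) (λ { refl → i′≢i refl }) (λ { refl → i′≢u refl })

    t-kept : ∀ j → C′ (tv j) ≡ C (tv j)
    t-kept j = pebble-other C (sv i) (sv u) (tv j) (λ ()) (λ ())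

    shifted : C (sv i) ≡ 2 → C (sv u) ≡ 0 → kFree C′ ≡ kFree C
    shifted two empty = +-cancelʳ-≡ 1 (kFree C′) (kFree C) (begin
      kFree C′ + 1                                 ≡⟨ cong₂ (λ a b → kFree C′ + (free a + free b)) (sym two) (sym empty) ⟩
      kFree C′ + (free (C (sv i)) + free (C (sv u))) ≡⟨ ΣS-update₂ free C C′ i u i≢u s-kept ⟩
      kFree C + (free (C′ (sv i)) + free (C′ (sv u))) ≡⟨ cong₂ (λ a b → kFree C + (free a + free b)) (trans s-source (cong (_∸ 2) two)) (trans s-target (cong suc empty)) ⟩
      kFree C + 1                                  ∎)
      where open ≡-Reasoning

    threats-same : CT C′ ≡ CT C
    threats-same = ΣT-cong (_/ 2) C C′ t-kept

    t-pebbles-same : tPebbles C′ ≡ tPebbles C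
    t-pebbles-same = ΣT-cong (λ c → c) C C′ t-kept

module Strategy {s t : ℕ} (H : SimpleGraph s) (t≥2 : 2 ≤ t) where

  FreeNeighbours : Config s t → Set
  FreeNeighbours C = ∀ i → 1 ≤ C (sv i) → Σ (Fin s) λ u → T (E H i u) × (C (sv u) ≡ 0)

  -- The four shapes from which Defender can always restore a shape.
  data Safe (C : Config s t) : Set where
    slack₀ : CT C ≤ kFree C → Safe C
    slack₁ : Even (kFree C) → CT C ≤ 1 + kFree C → Safe C
    slack₂-partner : Even (kFree C) → CT C ≤ 2 + kFree C → EvenPartner C → Safe C
    slack₂-neighbours : (x : Fin t) → Even (kFree C) → CT C ≤ 2 + kFree C →
      C (tv x) ≡ 2 → FreeNeighbours C → Safe C

  record Invariant (C : Config s t) : Set where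
    constructor invariant
    field
      root-empty : C root ≡ 0
      s-bounded : SBounded C
      safe : Safe C

  WinsBelow : Config s t → Set
  WinsBelow C = ∀ C′ → tPebbles C′ < tPebbles C → Invariant C′ → DefWinsM H C′

  respond : ∀ {C C₁ : Config s t} {u v} a b → Move H C₁ a b → ¬ (a ≡ v × b ≡ u) →
    Invariant (pebble C₁ a b) → tPebbles (pebble C₁ a b) < tPebbles C → WinsBelow C →
    DefWinsD H C₁ u v
  respond a b move allowed inv fewer ih =
    defender-move a b move allowed (Invariant.root-empty inv) (ih _ fewer inv)

  no-moves : ∀ {C : Config s t} {u v} → C root ≡ 0 → SBounded C → (∀ j → ¬ 2 ≤ C (tv j)) → DefWinsD H C u v
  no-moves root-empty bounded stuck = defender-stuck λ where
    root _ (_ , 2≤) → ⊥-elim (cannot-move (≤-trans (≤-reflexive root-empty) z≤n) 2≤)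
    (sv i) _ (_ , 2≤) → ⊥-elim (cannot-move (bounded i) 2≤)
    (tv j) _ (_ , 2≤) → ⊥-elim (stuck j 2≤)

  -- Mover filled the free vertex sv i from tv j: Defender fills another
  -- free vertex from T, emptying the two-pebble pile x if there is one.
  answer-fill : ∀ {C : Config s t} j i → Invariant C → WinsBelow C → 2 ≤ C (tv j) → C (sv i) ≡ 0 →
    DefWinsD H (TtoS.C′ C j i) (tv j) (sv i)
  answer-fill {C} j i inv ih 2≤ empty = answer (FinP.any? λ j₀ → 2 ≤? C₁ (tv j₀))
    where
    open Invariant inv
    module M = TtoS C j i
    C₁ : Config s t
    C₁ = M.C′

    bounded₁ : SBounded C₁
    bounded₁ = M.fill-bounded s-bounded empty

    k-drop : suc (kFree C₁) ≡ kFree C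
    k-drop = M.filled empty

    -- With k even, the vertex Mover filled was not the last free one.
    free-if-even : Even (kFree C) → 1 ≤ kFree C₁
    free-if-even even = ≤-pred (subst (2 ≤_) (sym k-drop)
      (even-≥2 even (subst (1 ≤_) k-drop (s≤s z≤n))))

    -- With C_T ≤ k, a remaining threat needs a free vertex to match it.
    free-if-threat : ∀ j₀ → 2 ≤ C₁ (tv j₀) → CT C ≤ kFree C → 1 ≤ kFree C₁
    free-if-threat j₀ 2≤₀ budget = ≤-trans (threat-positive C₁ j₀ 2≤₀)
      (≤-pred (subst₂ _≤_ (sym (M.threats-drop 2≤)) (sym k-drop) budget))

    refill : ∀ j′ → 2 ≤ C₁ (tv j′) → 1 ≤ kFree C₁ →
      (∀ i₀ → Lowered C (TtoS.C′ C₁ j′ i₀) → Safe (TtoS.C′ C₁ j′ i₀)) →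
      DefWinsD H C₁ (tv j) (sv i)
    refill j′ 2≤′ free₁ safe₂ with free-vertex C₁ free₁
    ... | i₀ , empty₀ = respond {C} (tv j′) (sv i₀) (_ , 2≤′) (λ { (() , _) })
          (invariant root₂ (M₂.fill-bounded bounded₁ empty₀) (safe₂ i₀ lowered))
          fewer ih
      where
      module M₂ = TtoS C₁ j′ i₀
      root₂ : M₂.C′ root ≡ 0
      root₂ = trans M₂.root-kept (trans M.root-kept root-empty)
      lowered : Lowered C M₂.C′
      lowered = record
        { free-drop = trans (sym k-drop) (cong suc (sym (M₂.filled empty₀)))
        ; threat-drop = trans (sym (M.threats-drop 2≤)) (cong suc (sym (M₂.threats-drop 2≤′)))
        }
      fewer : tPebbles M₂.C′ < tPebbles C
      fewer = ≤-trans (n≤1+n _) (≤-trans (m≤n+m _ 2)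
        (≤-reflexive (trans (cong (2 +_) (M₂.t-pebbles-drop 2≤′)) (M.t-pebbles-drop 2≤))))

    by-shape : ∀ j₀ → 2 ≤ C₁ (tv j₀) → Safe C → DefWinsD H C₁ (tv j) (sv i)
    by-shape j₀ 2≤₀ (slack₀ budget) = refill j₀ 2≤₀ (free-if-threat j₀ 2≤₀ budget)
      λ _ low → slack₀ (lowered-budget low 0 budget)
    by-shape j₀ 2≤₀ (slack₁ even budget) = refill j₀ 2≤₀ (free-if-even even)
      λ _ low → slack₁ (lowered-even low even) (lowered-budget low 1 budget)
    by-shape j₀ 2≤₀ (slack₂-partner even budget partner) = refill j₀ 2≤₀ (free-if-even even)
      λ i₀ low → slack₂-partner (lowered-even low even) (lowered-budget low 2 budget)
        (TtoS.partner-kept C₁ j₀ i₀ (M.partner-kept partner))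
    by-shape j₀ 2≤₀ (slack₂-neighbours x even budget two _) with j FinP.≟ x
    ... | yes refl = refill j₀ 2≤₀ (free-if-even even)
      λ i₀ low → slack₂-partner (lowered-even low even) (lowered-budget low 2 budget)
        (empty-partner (TtoS.C′ C₁ j₀ i₀) x (trans (TtoS.t-kept C₁ j₀ i₀ x x≢j₀) x-empty₁))
      where
      x-empty₁ : C₁ (tv x) ≡ 0
      x-empty₁ = trans M.t-source (cong (_∸ 2) two)
      x≢j₀ : x ≢ j₀
      x≢j₀ refl = cannot-move (≤-trans (≤-reflexive x-empty₁) z≤n) 2≤₀
    ... | no j≢x = refill x (≤-reflexive (sym x-two₁)) (free-if-even even)
      λ i₀ low → slack₂-partner (lowered-even low even) (lowered-budget low 2 budget)
        (empty-partner (TtoS.C′ C₁ x i₀) x (trans (TtoS.t-source C₁ x i₀) (cong (_∸ 2) x-two₁)))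
      where
      x-two₁ : C₁ (tv x) ≡ 2
      x-two₁ = trans (M.t-kept x (λ x≡j → j≢x (sym x≡j))) two

    answer : Dec (∃ λ j₀ → 2 ≤ C₁ (tv j₀)) → DefWinsD H C₁ (tv j) (sv i)
    answer (yes (j₀ , 2≤₀)) = by-shape j₀ 2≤₀ safe
    answer (no none) = no-moves (trans M.root-kept root-empty) bounded₁ (λ j₀ 2≤₀ → none (j₀ , 2≤₀))

  -- Mover doubled the pebble on sv i from tv j: Defender moves the pair off
  -- sv i, back to another T-pile or, in the last shape, to a free neighbour.
  answer-threat : ∀ {C : Config s t} j i → Invariant C → WinsBelow C → 2 ≤ C (tv j) → C (sv i) ≡ 1 →
    DefWinsD H (TtoS.C′ C j i) (tv j) (sv i)
  answer-threat {C} j i inv ih 2≤ one = by-shape safe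
    where
    open Invariant inv
    module M = TtoS C j i
    C₁ : Config s t
    C₁ = M.C′

    pair₁ : C₁ (sv i) ≡ 2
    pair₁ = trans M.s-target (cong suc one)

    k-same : kFree C₁ ≡ kFree C
    k-same = M.doubled one

    threats₁ : suc (CT C₁) ≡ CT C
    threats₁ = M.threats-drop 2≤

    -- Mover's threat consumed one unit of a C_T ≤ 2 + k budget.
    budget₁ : CT C ≤ 2 + kFree C → CT C₁ ≤ 1 + kFree C
    budget₁ budget = ≤-pred (subst (_≤ 2 + kFree C) (sym threats₁) budget)

    -- Defender returns the pair to tv j′; the freed vertex pays for any new threat.
    retreat : ∀ j′ → j′ ≢ j → CT (StoT.C′ C₁ i j′) ≤ suc (kFree C) → DefWinsD H C₁ (tv j) (sv i)
    retreat j′ j′≢j budget₂ = respond {C} (sv i) (tv j′) (_ , ≤-reflexive (sym pair₁))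
      (λ { (_ , refl) → j′≢j refl }) (invariant root₂ bounded₂ (slack₀ safe₂)) fewer ih
      where
      module R = StoT C₁ i j′
      root₂ : R.C′ root ≡ 0
      root₂ = trans R.root-kept (trans M.root-kept root-empty)
      bounded₂ : SBounded R.C′
      bounded₂ = at-and-off (λ i′ → R.C′ (sv i′) ≤ 1) i
        (subst (_≤ 1) (sym (trans R.s-source (cong (_∸ 2) pair₁))) z≤n)
        (λ i′ i′≢i → subst (_≤ 1) (sym (trans (R.s-kept i′ i′≢i) (M.s-kept i′ i′≢i))) (s-bounded i′))
      safe₂ : CT R.C′ ≤ kFree R.C′
      safe₂ = subst (CT R.C′ ≤_) (sym (trans (R.emptied pair₁) (cong suc k-same))) budget₂
      fewer : tPebbles R.C′ < tPebbles C
      fewer = ≤-reflexive (trans (cong suc R.t-pebbles-rise) (M.t-pebbles-drop 2≤))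

    threats-back : ∀ j′ → CT (StoT.C′ C₁ i j′) ≤ CT C
    threats-back j′ = subst (CT (StoT.C′ C₁ i j′) ≤_) threats₁ (StoT.threats-rise C₁ i j′)

    shift : ∀ u → T (E H i u) → C (sv u) ≡ 0 → Even (kFree C) → CT C ≤ 2 + kFree C →
      DefWinsD H C₁ (tv j) (sv i)
    shift u edge empty-u even budget = respond {C} (sv i) (sv u) (edge , ≤-reflexive (sym pair₁))
      (λ { (_ , ()) }) (invariant root₂ bounded₂ (slack₁ (subst Even (sym k₂) even) safe₂)) fewer ih
      where
      i≢u : i ≢ u
      i≢u refl = subst T (irrefl H i) edge
      u≢i : u ≢ i
      u≢i u≡i = i≢u (sym u≡i)
      module R = StoS C₁ i u i≢u
      k₂ : kFree R.C′ ≡ kFree C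
      k₂ = trans (R.shifted pair₁ (trans (M.s-kept u u≢i) empty-u)) k-same
      root₂ : R.C′ root ≡ 0
      root₂ = trans R.root-kept (trans M.root-kept root-empty)
      bounded₂ : SBounded R.C′
      bounded₂ = at-and-off (λ i′ → R.C′ (sv i′) ≤ 1) i
        (subst (_≤ 1) (sym (trans R.s-source (cong (_∸ 2) pair₁))) z≤n)
        (at-and-off (λ i′ → i′ ≢ i → R.C′ (sv i′) ≤ 1) u
          (λ _ → ≤-reflexive (trans R.s-target (cong suc (trans (M.s-kept u u≢i) empty-u))))
          (λ i′ i′≢u i′≢i → subst (_≤ 1) (sym (trans (R.s-kept i′ i′≢i i′≢u) (M.s-kept i′ i′≢i)))
            (s-bounded i′)))
      safe₂ : CT R.C′ ≤ 1 + kFree R.C′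
      safe₂ = subst₂ (λ c k → c ≤ 1 + k) (sym R.threats-same) (sym k₂) (budget₁ budget)
      fewer : tPebbles R.C′ < tPebbles C
      fewer = subst (_< tPebbles C) (sym R.t-pebbles-same)
        (≤-trans (n≤1+n _) (≤-reflexive (M.t-pebbles-drop 2≤)))

    by-shape : Safe C → DefWinsD H C₁ (tv j) (sv i)
    by-shape (slack₀ budget) with another t≥2 j
    ... | j′ , j′≢j = retreat j′ j′≢j (≤-trans (threats-back j′) (≤-trans budget (n≤1+n _)))
    by-shape (slack₁ _ budget) with another t≥2 j
    ... | j′ , j′≢j = retreat j′ j′≢j (≤-trans (threats-back j′) budget)
    by-shape (slack₂-partner _ budget partner) with partner j 2≤
    ... | j′ , j′≢j , even = retreat j′ j′≢j
      (subst (_≤ 1 + kFree C) (sym (StoT.threats-kept C₁ i j′ (subst Even (sym (M.t-kept j′ j′≢j)) even)))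
        (budget₁ budget))
    by-shape (slack₂-neighbours _ even budget _ neighbours) with neighbours i (≤-reflexive (sym one))
    ... | u , edge , empty-u = shift u edge empty-u even budget

  defender-wins : ∀ n (C : Config s t) → tPebbles C < n → Invariant C → DefWinsM H C
  defender-wins (suc n) C bound inv = mover-turn root-empty mover
    where
    open Invariant inv
    ih : WinsBelow C
    ih C′ fewer = defender-wins n C′ (<-≤-trans fewer (≤-pred bound))
    mover : ∀ a b → Move H C a b → (pebble C a b root ≡ 0) × DefWinsD H (pebble C a b) a b
    mover root _ (_ , 2≤) = ⊥-elim (cannot-move (≤-trans (≤-reflexive root-empty) z≤n) 2≤)
    mover (sv i) _ (_ , 2≤) = ⊥-elim (cannot-move (s-bounded i) 2≤)
    mover (tv j) (sv i) (_ , 2≤) = trans (TtoS.root-kept C j i) root-empty , answer (C (sv i)) refl (s-bounded i)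
      where
      answer : ∀ c → C (sv i) ≡ c → c ≤ 1 → DefWinsD H (pebble C (tv j) (sv i)) (tv j) (sv i)
      answer zero empty _ = answer-fill j i inv ih 2≤ empty
      answer (suc zero) one _ = answer-threat j i inv ih 2≤ one
      answer (suc (suc _)) _ (s≤s ())

lemma3p12 : (s t : ℕ) → 1 ≤ s → 2 ≤ t →
    (H : SimpleGraph s) (C : Config s t) (x : Fin t) →
    Boundary C x →
    C (tv x) ≡ 2 →
    (∀ i → 1 ≤ C (sv i) → Σ (Fin s) λ j → T (E H i j) × (C (sv j) ≡ 0)) →
    DefenderWins H C
lemma3p12 s t _ t≥2 H C x ((root-empty , s-bounded) , even-k , threats , _ , _ , _) two neighbours =
  defender-wins (suc (tPebbles C)) C (n<1+n _) (invariant root-empty s-bounded start)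
  where
  open Strategy H t≥2
  -- A boundary configuration has C_T = k + 2 with k even: the last safe shape.
  start : Safe C
  start = slack₂-neighbours x even-k (≤-reflexive (trans threats (+-comm (kFree C) 2))) two neighbours
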